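{- For every prime $p \ge 5$, there exists a set $A \subseteq \mathbb{F}_p$ such that $|A| = \frac{p-1}{2}$, $1 \notin A+A$, and $1 \notin AA$.
   Context: $\mathbb{F}_p$ denotes the field with $p$ elements. For $A \subseteq \mathbb{F}_p$, $A+A = \{a+a' : a,a' \in A\}$ and $AA = \{aa' : a,a' \in A\}$ (with $a=a'$ allowed). -}

module Defs where

open import Data.Nat using (ℕ; suc; NonZero)
import Data.Nat as ℕ
open import Data.Nat.DivMod using (_mod_)
open import Data.Fin using (Fin; toℕ)
open import Data.Fin.Subset using (Subset; _∈_)
open import Data.Product using (Σ; _×_)
open import Relation.Binary.PropositionalEquality using (_≡_)

module _ (p : ℕ) .{{_ : NonZero p}} where

  _+ₚ_ : Fin p → Fin p → Fin p
  x +ₚ y = (toℕ x ℕ.+ toℕ y) mod p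

  _*ₚ_ : Fin p → Fin p → Fin p
  x *ₚ y = (toℕ x ℕ.* toℕ y) mod p

  oneₚ : Fin p
  oneₚ = 1 mod p

  InSumset : Subset p → Fin p → Set
  InSumset A z = Σ (Fin p) λ a → Σ (Fin p) λ a' → a ∈ A × a' ∈ A × (a +ₚ a') ≡ z

  InProductset : Subset p → Fin p → Set
  InProductset A z = Σ (Fin p) λ a → Σ (Fin p) λ a' → a ∈ A × a' ∈ A × (a *ₚ a') ≡ z

module Submission where

open import Defs
open import Data.Nat using (ℕ; _≤_; _∸_; _/_; NonZero)
open import Data.Nat.Primality using (Prime)
open import Data.Fin.Subset using (Subset; ∣_∣)
open import Data.Product using (Σ; _×_)
open import Relation.Nullary using (¬_)
open import Relation.Binary.PropositionalEquality using (_≡_)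

import Data.Nat.Properties as ℕ
open import Algebra.Properties.CommutativeMonoid.Sum ℕ.+-0-commutativeMonoid
  using (sum-syntax; sum-cong-≗; sum-permute; ∑-distrib-+; sum-replicate-zero)
open import Data.Bool using (true; false; if_then_else_)
open import Data.Empty using (⊥)
open import Data.Fin as Fin using (Fin; toℕ)
open import Data.Fin.Permutation using (Permutation; permutation)
open import Data.Fin.Properties as Finₚ using (_≟_; toℕ-injective; toℕ<n)
open import Data.Fin.Subset using (_∈_)
open import Data.Integer as ℤ using (ℤ; +_; -_; _+_; _-_; _*_; _⊖_; 0ℤ; 1ℤ; -1ℤ)
open import Data.Integer.Divisibility.Signed
  using (_∣_; divides; _∣?_; ∣m∣n⇒∣m+n; ∣n⇒∣m*n; ∣⇒∣ᵤ; ∣ᵤ⇒∣)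
import Data.Integer.Properties as ℤ
open import Data.Integer.Tactic.RingSolver using (solve)
open import Data.List using (_∷_; [])
open import Data.Nat as ℕ using (zero; suc; _<_; z<s)
open import Data.Nat.DivMod using (_mod_; _%_; m≡m%n+[m/n]*n; m%n<n; m*n/n≡m)
open import Data.Nat.Divisibility using (>⇒∤; m%n≡0⇒n∣m) renaming (_∣_ to _∣ℕ_)
open import Data.Nat.Primality using (euclidsLemma; composite-≢; prime⇒¬composite)
open import Data.Nat.Tactic.RingSolver using (solve-∀)
open import Data.Product using (_,_; ∃-syntax)
open import Data.Product.Relation.Binary.Lex.Strict using (×-Lex; ×-compare)
open import Data.Sum as Sum using (_⊎_; inj₁; inj₂)
open import Data.Vec using (tabulate)
open import Data.Vec.Properties using (lookup∘tabulate; []=⇒lookup)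
open import Function using (_∘_)
open import Level using (Level; 0ℓ)
open import Relation.Binary.Consequences using (tri⇒dec<; tri⇒asym)
open import Relation.Binary.Core using (Rel)
open import Relation.Binary.Definitions using (Trichotomous; Tri; tri<; tri≈; tri>)
open import Relation.Binary.PropositionalEquality
  using (refl; sym; trans; cong; cong₂; subst; subst₂; module ≡-Reasoning)
open import Relation.Nullary using (Dec; yes; no; does; contradiction)
open import Relation.Nullary.Decidable using (dec-true; dec-false; map′)
open import Relation.Unary using (Pred; Decidable; _⊆_; _≐_)

-- The map τ(x) = 1/(1 - x) permutes 𝔽_p ∖ {0, 1} with order 3, and ρ(x) = 1 - x conjugates τ
-- to τ⁻¹, so ρ permutes the τ-orbits; moreover 1/a = τ(1 - a), so 1/a lies in the τ-orbit of 1 - a.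
-- From each pair {x, 1 - x} put into A the element whose τ-orbit has the smaller least element,
-- ties broken by x itself. If a + b = 1 then b = 1 - a is the partner of a, so not both lie in A.
-- If ab = 1 with a, b ∈ A, then the orbit of a is at most the orbit of 1 - a, which is the orbit
-- of b, and symmetrically; so a and 1 - a have the same orbit, which only happens for
-- a ∈ {0, 1, -1, 2, 1/2}, and these cases are checked by hand. Since 1/2 is the only fixed point
-- of ρ, A has exactly (p - 1)/2 elements.

private
  variable
    a b c ℓ ℓ₁ ℓ₂ : Level
    n : ℕ

least : {P : Pred (Fin n) ℓ} → Decidable P → ℕ
least {zero}  P? = 0
least {suc n} P? with P? Fin.zero
... | yes _ = 0
... | no  _ = suc (least (P? ∘ Fin.suc))

least-cong : {P : Pred (Fin n) ℓ₁} {Q : Pred (Fin n) ℓ₂} (P? : Decidable P) (Q? : Decidable Q) →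
             P ≐ Q → least P? ≡ least Q?
least-cong {zero}  P? Q? _ = refl
least-cong {suc n} P? Q? (P⊆Q , Q⊆P) with P? Fin.zero | Q? Fin.zero
... | yes _  | yes _  = refl
... | yes P0 | no ¬Q0 = contradiction (P⊆Q P0) ¬Q0
... | no ¬P0 | yes Q0 = contradiction (Q⊆P Q0) ¬P0
... | no _   | no _   = cong suc (least-cong (P? ∘ Fin.suc) (Q? ∘ Fin.suc) (P⊆Q , Q⊆P))

least-witness : {P : Pred (Fin n) ℓ} (P? : Decidable P) {i : Fin n} → P i →
                ∃[ j ] toℕ j ≡ least P? × P j
least-witness {suc n} P? {i} Pi with P? Fin.zero | i
... | yes P0 | _         = Fin.zero , refl , P0
... | no ¬P0 | Fin.zero  = contradiction Pi ¬P0
... | no _   | Fin.suc i =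
  let j , j≡least , Pj = least-witness (P? ∘ Fin.suc) Pi in Fin.suc j , cong suc j≡least , Pj

least-common : {P : Pred (Fin n) ℓ₁} {Q : Pred (Fin n) ℓ₂} (P? : Decidable P) (Q? : Decidable Q)
               {i j : Fin n} → P i → Q j → least P? ≡ least Q? → ∃[ k ] P k × Q k
least-common {Q = Q} P? Q? Pi Qj same =
  let k , k≡least , Pk = least-witness P? Pi
      l , l≡least , Ql = least-witness Q? Qj
  in k , Pk , subst Q (toℕ-injective (trans l≡least (trans (sym same) (sym k≡least)))) Ql

indicator : {A : Set a} → Dec A → ℕ
indicator A? = if does A? then 1 else 0

indicator-cong : {A : Set a} {B : Set b} → (A → B) → (B → A) →
                 (A? : Dec A) (B? : Dec B) → indicator A? ≡ indicator B?
indicator-cong A→B B→A (yes a) B? rewrite dec-true B? (A→B a) = refl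
indicator-cong A→B B→A (no ¬a) B? rewrite dec-false B? (¬a ∘ B→A) = refl

tri-indicator : {A : Set a} {B : Set b} {C : Set c} → Tri A B C →
                (A? : Dec A) (B? : Dec B) (C? : Dec C) →
                indicator A? ℕ.+ indicator B? ℕ.+ indicator C? ≡ 1
tri-indicator (tri< a ¬b ¬c) A? B? C? rewrite dec-true A? a | dec-false B? ¬b | dec-false C? ¬c = refl
tri-indicator (tri≈ ¬a b ¬c) A? B? C? rewrite dec-false A? ¬a | dec-true B? b | dec-false C? ¬c = refl
tri-indicator (tri> ¬a ¬b c) A? B? C? rewrite dec-false A? ¬a | dec-false B? ¬b | dec-true C? c = refl

∣tabulate∣≡∑indicator : {P : Pred (Fin n) ℓ} (P? : Decidable P) →
                        ∣ tabulate (does ∘ P?) ∣ ≡ ∑[ i < n ] indicator (P? i)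
∣tabulate∣≡∑indicator {zero}  P? = refl
∣tabulate∣≡∑indicator {suc n} P? with does (P? Fin.zero)
... | true  = cong suc (∣tabulate∣≡∑indicator (P? ∘ Fin.suc))
... | false = ∣tabulate∣≡∑indicator (P? ∘ Fin.suc)

∈-tabulate-does : {P : Pred (Fin n) ℓ} (P? : Decidable P) {i : Fin n} →
                  i ∈ tabulate (does ∘ P?) → P i
∈-tabulate-does P? {i} i∈
  with P? i | trans (sym (lookup∘tabulate (does ∘ P?) i)) ([]=⇒lookup i∈)
... | yes Pi | _  = Pi
... | no _   | ()

∑-ones : ∀ n → ∑[ i < n ] 1 ≡ n
∑-ones zero    = refl
∑-ones (suc n) = cong suc (∑-ones n)

∑-indicator-≟ : (h : Fin n) → ∑[ i < n ] indicator (i ≟ h) ≡ 1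
∑-indicator-≟ {suc n} Fin.zero    = cong suc (sum-replicate-zero n)
∑-indicator-≟ {suc n} (Fin.suc h) = ∑-indicator-≟ h

module PairSelection {_≺_ : Rel (Fin n) ℓ} (compare : Trichotomous _≡_ _≺_)
                     (ι : Fin n → Fin n) (ι-involutive : ∀ x → ι (ι x) ≡ x) where

  Lesser : Pred (Fin n) ℓ
  Lesser x = x ≺ ι x

  lesser? : Decidable Lesser
  lesser? x = tri⇒dec< compare x (ι x)

  lessers : Subset n
  lessers = tabulate (does ∘ lesser?)

  ∈-lessers : ∀ {x} → x ∈ lessers → Lesser x
  ∈-lessers = ∈-tabulate-does lesser?

  lesser⇒¬lesser-ι : ∀ {x} → Lesser x → ¬ Lesser (ι x)
  lesser⇒¬lesser-ι {x} x≺ιx ιx≺ιιx =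
    tri⇒asym compare x≺ιx (subst (ι x ≺_) (ι-involutive x) ιx≺ιιx)

  module _ (h : Fin n) (h-fixed : ι h ≡ h) (fixed⇒h : ∀ {x} → ι x ≡ x → x ≡ h) where

    pair-partition : ∀ x →
                     indicator (lesser? x) ℕ.+ indicator (x ≟ h) ℕ.+ indicator (lesser? (ι x)) ≡ 1
    pair-partition x = begin
      indicator (lesser? x) ℕ.+ indicator (x ≟ h) ℕ.+ indicator (lesser? (ι x))
        ≡⟨ cong₂ (λ i j → indicator (lesser? x) ℕ.+ i ℕ.+ j)
                 (indicator-cong (λ { refl → sym h-fixed }) (fixed⇒h ∘ sym) (x ≟ h) (x ≟ ι x))
                 (indicator-cong (subst (ι x ≺_) (ι-involutive x))
                                 (subst (ι x ≺_) (sym (ι-involutive x)))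
                                 (lesser? (ι x)) ιx≺x?) ⟩
      indicator (lesser? x) ℕ.+ indicator (x ≟ ι x) ℕ.+ indicator ιx≺x?
        ≡⟨ tri-indicator (compare x (ι x)) (lesser? x) (x ≟ ι x) ιx≺x? ⟩
      1 ∎
      where
      open ≡-Reasoning
      ιx≺x? : Dec (ι x ≺ x)
      ιx≺x? = tri⇒dec< compare (ι x) x

    1+∣lessers∣*2≡n : 1 ℕ.+ ∣ lessers ∣ ℕ.* 2 ≡ n
    1+∣lessers∣*2≡n = begin
      1 ℕ.+ ∣ lessers ∣ ℕ.* 2
        ≡⟨ rearrange ∣ lessers ∣ ⟩
      ∣ lessers ∣ ℕ.+ 1 ℕ.+ ∣ lessers ∣
        ≡⟨ cong₂ (λ i j → i ℕ.+ 1 ℕ.+ j) ∣lessers∣≡∑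
                 (trans ∣lessers∣≡∑ (sum-permute L ι-permutation)) ⟩
      ∑[ x < n ] L x ℕ.+ 1 ℕ.+ ∑[ x < n ] L (ι x)
        ≡⟨ cong (λ i → ∑[ x < n ] L x ℕ.+ i ℕ.+ ∑[ x < n ] L (ι x)) (∑-indicator-≟ h) ⟨
      ∑[ x < n ] L x ℕ.+ ∑[ x < n ] H x ℕ.+ ∑[ x < n ] L (ι x)
        ≡⟨ cong (ℕ._+ ∑[ x < n ] L (ι x)) (∑-distrib-+ L H) ⟨
      ∑[ x < n ] (L x ℕ.+ H x) ℕ.+ ∑[ x < n ] L (ι x)
        ≡⟨ ∑-distrib-+ (λ x → L x ℕ.+ H x) (L ∘ ι) ⟨
      ∑[ x < n ] (L x ℕ.+ H x ℕ.+ L (ι x))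
        ≡⟨ sum-cong-≗ pair-partition ⟩
      ∑[ x < n ] 1
        ≡⟨ ∑-ones n ⟩
      n ∎
      where
      open ≡-Reasoning
      L H : Fin n → ℕ
      L x = indicator (lesser? x)
      H x = indicator (x ≟ h)
      ∣lessers∣≡∑ : ∣ lessers ∣ ≡ ∑[ x < n ] L x
      ∣lessers∣≡∑ = ∣tabulate∣≡∑indicator lesser?
      ι-permutation : Permutation n n
      ι-permutation = permutation ι ι ι-involutive ι-involutive
      rearrange : ∀ k → 1 ℕ.+ k ℕ.* 2 ≡ k ℕ.+ 1 ℕ.+ k
      rearrange = solve-∀

module KeyOrder (key : Fin n → ℕ) where

  infix 4 _≺_

  _≺_ : Rel (Fin n) 0ℓ
  x ≺ y = ×-Lex _≡_ _<_ Fin._<_ (key x , x) (key y , y)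

  ≺-compare : Trichotomous _≡_ _≺_
  ≺-compare x y with ×-compare sym ℕ.<-cmp Finₚ.<-cmp (key x , x) (key y , y)
  ... | tri< x≺y x≉y y⊀x       = tri< x≺y (λ { refl → x≉y (refl , refl) }) y⊀x
  ... | tri≈ x⊀y (_ , x≡y) y⊀x = tri≈ x⊀y x≡y y⊀x
  ... | tri> x⊀y x≉y y≺x       = tri> x⊀y (λ { refl → x≉y (refl , refl) }) y≺x

  ≺⇒key≤ : ∀ {x y} → x ≺ y → key x ℕ.≤ key y
  ≺⇒key≤ (inj₁ kx<ky)       = ℕ.<⇒≤ kx<ky
  ≺⇒key≤ (inj₂ (kx≡ky , _)) = ℕ.≤-reflexive kx≡ky

  ≺∧key≡⇒< : ∀ {x y} → x ≺ y → key x ≡ key y → x Fin.< y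
  ≺∧key≡⇒< (inj₁ kx<ky)     kx≡ky = contradiction kx≡ky (ℕ.<⇒≢ kx<ky)
  ≺∧key≡⇒< (inj₂ (_ , x<y)) _     = x<y

module Congruence (m : ℤ) where

  infix 4 _≈_ _≈?_

  -- A record rather than a function, so that x and y can be read off from x ≈ y during unification.
  record _≈_ (x y : ℤ) : Set where
    constructor mk≈
    field m∣x-y : m ∣ x - y

  _≈?_ : ∀ x y → Dec (x ≈ y)
  x ≈? y = map′ mk≈ _≈_.m∣x-y (m ∣? x - y)

  quotient-≈ : ∀ {x y} q → x ≡ y + q * m → x ≈ y
  quotient-≈ {y = y} q refl = mk≈ (divides q (solve (y ∷ q ∷ m ∷ [])))

  m≈0 : m ≈ 0ℤ
  m≈0 = quotient-≈ 1ℤ (solve (m ∷ []))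

  ≈-refl : ∀ {x} → x ≈ x
  ≈-refl {x} = quotient-≈ 0ℤ (solve (x ∷ m ∷ []))

  ≈-reflexive : ∀ {x y} → x ≡ y → x ≈ y
  ≈-reflexive refl = ≈-refl

  ≈-by₁ : ∀ {x y u v} c → x ≈ y → u - v ≡ c * (x - y) → u ≈ v
  ≈-by₁ c (mk≈ m∣x-y) eq = mk≈ (subst (m ∣_) (sym eq) (∣n⇒∣m*n c m∣x-y))

  ≈-by₂ : ∀ {x₁ y₁ x₂ y₂ u v} c₁ c₂ → x₁ ≈ y₁ → x₂ ≈ y₂ →
          u - v ≡ c₁ * (x₁ - y₁) + c₂ * (x₂ - y₂) → u ≈ v
  ≈-by₂ c₁ c₂ (mk≈ m∣x₁-y₁) (mk≈ m∣x₂-y₂) eq =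
    mk≈ (subst (m ∣_) (sym eq)
               (∣m∣n⇒∣m+n (∣n⇒∣m*n c₁ m∣x₁-y₁) (∣n⇒∣m*n c₂ m∣x₂-y₂)))

  ≈-sym : ∀ {x y} → x ≈ y → y ≈ x
  ≈-sym {x} {y} x≈y = ≈-by₁ -1ℤ x≈y (solve (x ∷ y ∷ []))

  ≈-trans : ∀ {x y z} → x ≈ y → y ≈ z → x ≈ z
  ≈-trans {x} {y} {z} x≈y y≈z = ≈-by₂ 1ℤ 1ℤ x≈y y≈z (solve (x ∷ y ∷ z ∷ []))

  ≈0⇒≈ : ∀ {x y} → x - y ≈ 0ℤ → x ≈ y
  ≈0⇒≈ {x} {y} x-y≈0 = ≈-by₁ 1ℤ x-y≈0 (solve (x ∷ y ∷ []))

module Residues (p : ℕ) .{{_ : NonZero p}} where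

  open Congruence (+ p) public

  private
    +≈+∧≤⇒≡ : ∀ {i j} → i ℕ.≤ j → j < p → + i ≈ + j → i ≡ j
    +≈+∧≤⇒≡ {i} {j} i≤j j<p (mk≈ p∣i-j) =
      ℕ.≤-antisym i≤j
        (ℕ.m∸n≡0⇒m≤n (small-multiple (ℕ.≤-<-trans (ℕ.m∸n≤m j i) j<p) p∣j∸i))
      where
      p∣j∸i : p ∣ℕ j ∸ i
      p∣j∸i = subst (p ∣ℕ_) (trans (cong ℤ.∣_∣ (ℤ.m-n≡m⊖n i j)) (ℤ.∣⊖∣-≤ i≤j))
                    (∣⇒∣ᵤ p∣i-j)
      small-multiple : ∀ {k} → k < p → p ∣ℕ k → k ≡ 0
      small-multiple {zero}  _   _   = refl
      small-multiple {suc k} k<p p∣k = contradiction p∣k (>⇒∤ k<p)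

  +≈+⇒≡ : ∀ {i j} → i < p → j < p → + i ≈ + j → i ≡ j
  +≈+⇒≡ {i} {j} i<p j<p i≈j with ℕ.≤-total i j
  ... | inj₁ i≤j = +≈+∧≤⇒≡ i≤j j<p i≈j
  ... | inj₂ j≤i = sym (+≈+∧≤⇒≡ j≤i i<p (≈-sym i≈j))

  pos≉0 : ∀ {k} → 0 < k → k < p → ¬ + k ≈ 0ℤ
  pos≉0 0<k k<p k≈0 = ℕ.<⇒≢ 0<k (sym (+≈+⇒≡ k<p (ℕ.<-trans 0<k k<p) k≈0))

  ⟦_⟧ : Fin p → ℤ
  ⟦ x ⟧ = + toℕ x

  toℕ-≈ : ∀ {x k} → ⟦ x ⟧ ≈ + k → k < p → toℕ x ≡ k
  toℕ-≈ {x} x≈k k<p = +≈+⇒≡ (toℕ<n x) k<p x≈k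

  ⟦⟧-injective : ∀ {x y} → ⟦ x ⟧ ≈ ⟦ y ⟧ → x ≡ y
  ⟦⟧-injective {y = y} x≈y = toℕ-injective (toℕ-≈ x≈y (toℕ<n y))

  ⟦mod⟧ : ∀ k → ⟦ k mod p ⟧ ≈ + k
  ⟦mod⟧ k = ≈-sym (quotient-≈ (+ (k / p)) (begin
    + k
      ≡⟨ cong +_ (m≡m%n+[m/n]*n k p) ⟩
    + (k % p ℕ.+ k / p ℕ.* p)
      ≡⟨ cong (λ r → + r + + (k / p ℕ.* p)) (Finₚ.toℕ-fromℕ< (m%n<n k p)) ⟨
    ⟦ k mod p ⟧ + + (k / p ℕ.* p)
      ≡⟨ cong (λ q → ⟦ k mod p ⟧ + q) (ℤ.pos-* (k / p) p) ⟩
    ⟦ k mod p ⟧ + + (k / p) * + p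
      ∎))
    where open ≡-Reasoning

  mod-≡⇒≈ : ∀ {i j} → i mod p ≡ j mod p → + i ≈ + j
  mod-≡⇒≈ {i} {j} i≡j =
    ≈-trans (≈-sym (⟦mod⟧ i)) (subst (λ r → ⟦ r ⟧ ≈ + j) (sym i≡j) (⟦mod⟧ j))

  -- 1 - x; the summand p keeps the natural-number subtraction from truncating.
  reflect : Fin p → Fin p
  reflect x = (suc p ∸ toℕ x) mod p

  ⟦reflect⟧ : ∀ x → ⟦ reflect x ⟧ ≈ 1ℤ - ⟦ x ⟧
  ⟦reflect⟧ x = ≈-trans (⟦mod⟧ (suc p ∸ toℕ x)) (quotient-≈ 1ℤ (begin
    + (suc p ∸ toℕ x)       ≡⟨ ℤ.⊖-≥ (ℕ.m≤n⇒m≤1+n (ℕ.<⇒≤ (toℕ<n x))) ⟨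
    suc p ⊖ toℕ x           ≡⟨ ℤ.m-n≡m⊖n (suc p) (toℕ x) ⟨
    1ℤ + + p - ⟦ x ⟧        ≡⟨ regroup (+ p) ⟦ x ⟧ ⟩
    1ℤ - ⟦ x ⟧ + 1ℤ * + p   ∎))
    where
    open ≡-Reasoning
    regroup : ∀ P X → 1ℤ + P - X ≡ 1ℤ - X + 1ℤ * P
    regroup P X = solve (P ∷ X ∷ [])

  reflect-≈ : ∀ {x c} → ⟦ x ⟧ ≈ c → ⟦ reflect x ⟧ ≈ 1ℤ - c
  reflect-≈ {x} x≈c = ≈-trans (⟦reflect⟧ x) (1-‿cong x≈c)
    where
    1-‿cong : ∀ {X c} → X ≈ c → 1ℤ - X ≈ 1ℤ - c
    1-‿cong {X} {c} X≈c = ≈-by₁ -1ℤ X≈c (solve (X ∷ c ∷ []))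

  reflect-involutive : ∀ x → reflect (reflect x) ≡ x
  reflect-involutive x =
    ⟦⟧-injective (≈-trans (reflect-≈ (⟦reflect⟧ x)) (≈-reflexive (double-complement ⟦ x ⟧)))
    where
    double-complement : ∀ X → 1ℤ - (1ℤ - X) ≡ X
    double-complement X = solve (X ∷ [])

  2x≈1⇒reflect-fixed : ∀ {x} → + 2 * ⟦ x ⟧ ≈ 1ℤ → reflect x ≡ x
  2x≈1⇒reflect-fixed {x} 2x≈1 = ⟦⟧-injective (at-half (⟦reflect⟧ x) 2x≈1)
    where
    at-half : ∀ {X Y} → Y ≈ 1ℤ - X → + 2 * X ≈ 1ℤ → Y ≈ X
    at-half {X} {Y} Y≈1-X 2X≈1 = ≈-by₂ 1ℤ -1ℤ Y≈1-X 2X≈1 (solve (X ∷ Y ∷ []))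

  reflect-fixed⇒2x≈1 : ∀ {x} → reflect x ≡ x → + 2 * ⟦ x ⟧ ≈ 1ℤ
  reflect-fixed⇒2x≈1 {x} ρx≡x =
    self-complement (subst (λ y → ⟦ y ⟧ ≈ 1ℤ - ⟦ x ⟧) ρx≡x (⟦reflect⟧ x))
    where
    self-complement : ∀ {X} → X ≈ 1ℤ - X → + 2 * X ≈ 1ℤ
    self-complement {X} X≈1-X = ≈-by₁ 1ℤ X≈1-X (solve (X ∷ []))

  x+y≈1⇒y≡reflect : ∀ {x y} → ⟦ x ⟧ + ⟦ y ⟧ ≈ 1ℤ → y ≡ reflect x
  x+y≈1⇒y≡reflect {x} {y} x+y≈1 =
    ⟦⟧-injective (complements {⟦ x ⟧} {⟦ y ⟧} x+y≈1 (⟦reflect⟧ x))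
    where
    complements : ∀ {X Y Z} → X + Y ≈ 1ℤ → Z ≈ 1ℤ - X → Y ≈ Z
    complements {X} {Y} {Z} X+Y≈1 Z≈1-X =
      ≈-by₂ 1ℤ -1ℤ X+Y≈1 Z≈1-X (solve (X ∷ Y ∷ Z ∷ []))

module PrimeResidues (p : ℕ) .{{_ : NonZero p}} (p-prime : Prime p) where

  open Residues p public

  x*y≈0⇒x≈0⊎y≈0 : ∀ {x y} → x * y ≈ 0ℤ → x ≈ 0ℤ ⊎ y ≈ 0ℤ
  x*y≈0⇒x≈0⊎y≈0 {x} {y} xy≈0 =
    Sum.map (∣⇒≈0 ∘ ∣ᵤ⇒∣) (∣⇒≈0 ∘ ∣ᵤ⇒∣)
      (euclidsLemma ℤ.∣ x ∣ ℤ.∣ y ∣ p-prime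
        (subst (p ∣ℕ_) (ℤ.abs-* x y) (∣⇒∣ᵤ (≈0⇒∣ xy≈0))))
    where
    ≈0⇒∣ : ∀ {z} → z ≈ 0ℤ → + p ∣ z
    ≈0⇒∣ {z} (mk≈ p∣z-0) = subst (+ p ∣_) (ℤ.+-identityʳ z) p∣z-0
    ∣⇒≈0 : ∀ {z} → + p ∣ z → z ≈ 0ℤ
    ∣⇒≈0 {z} p∣z = mk≈ (subst (+ p ∣_) (sym (ℤ.+-identityʳ z)) p∣z)

  *-cancelˡ-≈ : ∀ {c x y} → ¬ c ≈ 0ℤ → c * x ≈ c * y → x ≈ y
  *-cancelˡ-≈ {c} {x} {y} c≉0 cx≈cy
    with x*y≈0⇒x≈0⊎y≈0 {c} {x - y} (≈-by₁ 1ℤ cx≈cy (solve (c ∷ x ∷ y ∷ [])))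
  ... | inj₁ c≈0   = contradiction c≈0 c≉0
  ... | inj₂ x-y≈0 = ≈0⇒≈ x-y≈0

  quadratic-roots : ∀ {x r s} → (x - r) * (x - s) ≈ 0ℤ → x ≈ r ⊎ x ≈ s
  quadratic-roots = Sum.map ≈0⇒≈ ≈0⇒≈ ∘ x*y≈0⇒x≈0⊎y≈0

  -- Y ∈ {X, τ X, τ² X} for τ(x) = 1/(1 - x), τ²(x) = (x - 1)/x, with the denominators cleared.
  data Orbit (X Y : ℤ) : Set where
    τ⁰ : Y ≈ X → Orbit X Y
    τ¹ : Y * (1ℤ - X) ≈ 1ℤ → Orbit X Y
    τ² : Y * X ≈ X - 1ℤ → Orbit X Y

  orbit? : ∀ X Y → Dec (Orbit X Y)
  orbit? X Y with Y ≈? X | Y * (1ℤ - X) ≈? 1ℤ | Y * X ≈? X - 1ℤ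
  ... | yes e  | _      | _      = yes (τ⁰ e)
  ... | no _   | yes e  | _      = yes (τ¹ e)
  ... | no _   | no _   | yes e  = yes (τ² e)
  ... | no ¬e₀ | no ¬e₁ | no ¬e₂ =
    no λ { (τ⁰ e₀) → ¬e₀ e₀ ; (τ¹ e₁) → ¬e₁ e₁ ; (τ² e₂) → ¬e₂ e₂ }

  orbit-refl : ∀ {X} → Orbit X X
  orbit-refl = τ⁰ ≈-refl

  orbit-resp : ∀ {X X'} → X ≈ X' → Orbit X ⊆ Orbit X'
  orbit-resp {X} {X'} X≈X' {Y} (τ⁰ e) = τ⁰ (≈-by₂ 1ℤ 1ℤ e X≈X' (solve (X ∷ X' ∷ Y ∷ [])))
  orbit-resp {X} {X'} X≈X' {Y} (τ¹ e) = τ¹ (≈-by₂ 1ℤ Y e X≈X' (solve (X ∷ X' ∷ Y ∷ [])))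
  orbit-resp {X} {X'} X≈X' {Y} (τ² e) = τ² (≈-by₂ 1ℤ (1ℤ - Y) e X≈X' (solve (X ∷ X' ∷ Y ∷ [])))

  orbit-reciprocal : ∀ {A B} → A * B ≈ 1ℤ → Orbit B ≐ Orbit (1ℤ - A)
  orbit-reciprocal {A} {B} AB≈1 = forward , backward
    where
    forward : Orbit B ⊆ Orbit (1ℤ - A)
    forward {Y} (τ⁰ e) = τ¹ (≈-by₂ A 1ℤ e AB≈1 (solve (A ∷ B ∷ Y ∷ [])))
    forward {Y} (τ¹ e) = τ² (≈-by₂ (- A) (- Y) e AB≈1 (solve (A ∷ B ∷ Y ∷ [])))
    forward {Y} (τ² e) = τ⁰ (≈-by₂ A (1ℤ - Y) e AB≈1 (solve (A ∷ B ∷ Y ∷ [])))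
    backward : Orbit (1ℤ - A) ⊆ Orbit B
    backward {Y} (τ⁰ e) = τ² (≈-by₂ B -1ℤ e AB≈1 (solve (A ∷ B ∷ Y ∷ [])))
    backward {Y} (τ¹ e) = τ⁰ (≈-by₂ B (- Y) e AB≈1 (solve (A ∷ B ∷ Y ∷ [])))
    backward {Y} (τ² e) = τ¹ (≈-by₂ (- B) (1ℤ - Y) e AB≈1 (solve (A ∷ B ∷ Y ∷ [])))

  data Exceptional (X : ℤ) : Set where
    ≈0  : X ≈ 0ℤ → Exceptional X
    ≈1  : X ≈ 1ℤ → Exceptional X
    ≈-1 : X ≈ -1ℤ → Exceptional X
    ≈2  : X ≈ + 2 → Exceptional X
    ≈½  : + 2 * X ≈ 1ℤ → Exceptional X

  orbits-meet⇒exceptional : ∀ {X Y} → Orbit X Y → Orbit (1ℤ - X) Y → Exceptional X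
  orbits-meet⇒exceptional {X} {Y} = meet
    where
    roots-±1 : (X - 1ℤ) * (X - -1ℤ) ≈ 0ℤ → Exceptional X
    roots-±1 = Sum.[ ≈1 , ≈-1 ] ∘ quadratic-roots {X} {1ℤ} { -1ℤ}
    roots-0-2 : (X - 0ℤ) * (X - + 2) ≈ 0ℤ → Exceptional X
    roots-0-2 = Sum.[ ≈0 , ≈2 ] ∘ quadratic-roots {X} {0ℤ} {+ 2}
    meet : Orbit X Y → Orbit (1ℤ - X) Y → Exceptional X
    meet (τ⁰ e) (τ⁰ f) = ≈½ (≈-by₂ -1ℤ 1ℤ e f (solve (X ∷ Y ∷ [])))
    meet (τ⁰ e) (τ¹ f) = roots-±1 (≈-by₂ (- X) 1ℤ e f (solve (X ∷ Y ∷ [])))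
    meet (τ⁰ e) (τ² f) = roots-0-2 (≈-by₂ (1ℤ - X) -1ℤ e f (solve (X ∷ Y ∷ [])))
    meet (τ¹ e) (τ⁰ f) = roots-0-2 (≈-by₂ 1ℤ (- (1ℤ - X)) e f (solve (X ∷ Y ∷ [])))
    meet (τ¹ e) (τ¹ f) = ≈½ (≈-by₂ (- X) (1ℤ - X) e f (solve (X ∷ Y ∷ [])))
    meet (τ¹ e) (τ² f) = ≈-1 (≈-by₂ -1ℤ 1ℤ e f (solve (X ∷ Y ∷ [])))
    meet (τ² e) (τ⁰ f) = roots-±1 (≈-by₂ -1ℤ X e f (solve (X ∷ Y ∷ [])))
    meet (τ² e) (τ¹ f) = ≈2 (≈-by₂ -1ℤ 1ℤ e f (solve (X ∷ Y ∷ [])))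
    meet (τ² e) (τ² f) = ≈½ (≈-by₂ (X - 1ℤ) X e f (solve (X ∷ Y ∷ [])))

module Construction (p : ℕ) .{{_ : NonZero p}} (p-prime : Prime p) (2<p : 2 < p) where

  open PrimeResidues p p-prime

  private
    1<p : 1 < p
    1<p = ℕ.<-trans (ℕ.n<1+n 1) 2<p
    0<p : 0 < p
    0<p = ℕ.<-trans z<s 1<p

  p-odd : p ≡ 1 ℕ.+ p / 2 ℕ.* 2
  p-odd with p % 2 in p%2≡r | m%n<n p 2
  ... | 0           | _ = contradiction (composite-≢ 2 (ℕ.<⇒≢ 2<p) (m%n≡0⇒n∣m p 2 p%2≡r))
                                        (prime⇒¬composite p-prime)
  ... | 1           | _ = trans (m≡m%n+[m/n]*n p 2) (cong (ℕ._+ p / 2 ℕ.* 2) p%2≡r)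
  ... | suc (suc _) | ℕ.s≤s (ℕ.s≤s ())

  half : Fin p
  half = suc (p / 2) mod p

  2*half≈1 : + 2 * ⟦ half ⟧ ≈ 1ℤ
  2*half≈1 = doubling {Q = + (p / 2)} (⟦mod⟧ (suc (p / 2))) p≡1+2q m≈0
    where
    p≡1+2q : + p ≡ 1ℤ + + (p / 2) * + 2
    p≡1+2q = trans (cong +_ p-odd) (cong (λ q → 1ℤ + q) (ℤ.pos-* (p / 2) 2))
    doubling : ∀ {H Q P} → H ≈ 1ℤ + Q → P ≡ 1ℤ + Q * + 2 → P ≈ 0ℤ → + 2 * H ≈ 1ℤ
    doubling {H} {Q} H≈1+Q refl P≈0 = ≈-by₂ (+ 2) 1ℤ H≈1+Q P≈0 (solve (H ∷ Q ∷ []))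

  reflect-fixed⇒half : ∀ {x} → reflect x ≡ x → x ≡ half
  reflect-fixed⇒half ρx≡x =
    ⟦⟧-injective (*-cancelˡ-≈ (pos≉0 z<s 2<p)
                              (≈-trans (reflect-fixed⇒2x≈1 ρx≡x) (≈-sym 2*half≈1)))

  key : Fin p → ℕ
  key x = least (orbit? ⟦ x ⟧ ∘ ⟦_⟧)

  key-cong : ∀ {x y} → Orbit ⟦ x ⟧ ≐ Orbit ⟦ y ⟧ → key x ≡ key y
  key-cong {x} {y} (⊆ , ⊇) = least-cong (orbit? ⟦ x ⟧ ∘ ⟦_⟧) (orbit? ⟦ y ⟧ ∘ ⟦_⟧) (⊆ , ⊇)

  key-reciprocal : ∀ {a b} → ⟦ a ⟧ * ⟦ b ⟧ ≈ 1ℤ → key b ≡ key (reflect a)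
  key-reciprocal {a} {b} ab≈1 with orbit-reciprocal {⟦ a ⟧} {⟦ b ⟧} ab≈1
  ... | ⊆ , ⊇ = key-cong ( (λ b~y → orbit-resp (≈-sym (⟦reflect⟧ a)) (⊆ b~y))
                         , (λ ρa~y → ⊇ (orbit-resp (⟦reflect⟧ a) ρa~y)) )

  key-reflect⇒exceptional : ∀ {x} → key x ≡ key (reflect x) → Exceptional ⟦ x ⟧
  key-reflect⇒exceptional {x} same
    with least-common (orbit? ⟦ x ⟧ ∘ ⟦_⟧) (orbit? ⟦ reflect x ⟧ ∘ ⟦_⟧) {x} {reflect x}
                      orbit-refl orbit-refl same
  ... | _ , x~y , ρx~y = orbits-meet⇒exceptional x~y (orbit-resp (⟦reflect⟧ x) ρx~y)

  open KeyOrder key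
  open PairSelection ≺-compare reflect reflect-involutive

  ¬exceptional-reciprocals-below-reflections :
    ∀ {a b} → Exceptional ⟦ a ⟧ → ⟦ a ⟧ * ⟦ b ⟧ ≈ 1ℤ →
    a Fin.< reflect a → b Fin.< reflect b → ⊥
  ¬exceptional-reciprocals-below-reflections (≈0 a≈0) ab≈1 _ _ =
    pos≉0 z<s 1<p (zero-not-invertible a≈0 ab≈1)
    where
    zero-not-invertible : ∀ {A B} → A ≈ 0ℤ → A * B ≈ 1ℤ → 1ℤ ≈ 0ℤ
    zero-not-invertible {A} {B} A≈0 AB≈1 = ≈-by₂ B -1ℤ A≈0 AB≈1 (solve (A ∷ B ∷ []))
  ¬exceptional-reciprocals-below-reflections (≈1 a≈1) _ a<ρa _ =
    ℕ.n≮0 (subst₂ _<_ (toℕ-≈ a≈1 1<p) (toℕ-≈ (reflect-≈ a≈1) 0<p) a<ρa)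
  ¬exceptional-reciprocals-below-reflections {a} (≈-1 a≈-1) _ a<ρa _ =
    pos≉0 z<s (ℕ.≤-<-trans (subst (toℕ a <_) (toℕ-≈ (reflect-≈ a≈-1) 2<p) a<ρa) 2<p)
              (successor a≈-1)
    where
    successor : ∀ {A} → A ≈ -1ℤ → 1ℤ + A ≈ 0ℤ
    successor {A} A≈-1 = ≈-by₁ 1ℤ A≈-1 (solve (A ∷ []))
  ¬exceptional-reciprocals-below-reflections (≈2 a≈2) ab≈1 _ b<ρb =
    Finₚ.<-irrefl (sym (2x≈1⇒reflect-fixed (halving a≈2 ab≈1))) b<ρb
    where
    halving : ∀ {A B} → A ≈ + 2 → A * B ≈ 1ℤ → + 2 * B ≈ 1ℤ
    halving {A} {B} A≈2 AB≈1 = ≈-by₂ (- B) 1ℤ A≈2 AB≈1 (solve (A ∷ B ∷ []))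
  ¬exceptional-reciprocals-below-reflections (≈½ 2a≈1) _ a<ρa _ =
    Finₚ.<-irrefl (sym (2x≈1⇒reflect-fixed 2a≈1)) a<ρa

  reciprocals-not-both-lesser : ∀ {a b} → ⟦ a ⟧ * ⟦ b ⟧ ≈ 1ℤ → Lesser a → Lesser b → ⊥
  reciprocals-not-both-lesser {a} {b} ab≈1 a≺ρa b≺ρb =
    ¬exceptional-reciprocals-below-reflections (key-reflect⇒exceptional ka≡kρa) ab≈1
      (≺∧key≡⇒< a≺ρa ka≡kρa) (≺∧key≡⇒< b≺ρb kb≡kρb)
    where
    kρa≡kb : key (reflect a) ≡ key b
    kρa≡kb = sym (key-reciprocal {a} {b} ab≈1)
    kρb≡ka : key (reflect b) ≡ key a
    kρb≡ka = sym (key-reciprocal {b} {a} (subst (_≈ 1ℤ) (ℤ.*-comm ⟦ a ⟧ ⟦ b ⟧) ab≈1))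
    ka≡kb : key a ≡ key b
    ka≡kb = ℕ.≤-antisym (subst (key a ℕ.≤_) kρa≡kb (≺⇒key≤ a≺ρa))
                        (subst (key b ℕ.≤_) kρb≡ka (≺⇒key≤ b≺ρb))
    ka≡kρa : key a ≡ key (reflect a)
    ka≡kρa = trans ka≡kb (sym kρa≡kb)
    kb≡kρb : key b ≡ key (reflect b)
    kb≡kρb = trans (sym ka≡kb) (sym kρb≡ka)

  A : Subset p
  A = lessers

  ∣A∣ : ∣ A ∣ ≡ (p ∸ 1) / 2
  ∣A∣ = trans (sym (m*n/n≡m ∣ A ∣ 2)) (cong (λ n → (n ∸ 1) / 2) 1+∣A∣*2≡p)
    where
    1+∣A∣*2≡p : 1 ℕ.+ ∣ A ∣ ℕ.* 2 ≡ p
    1+∣A∣*2≡p = 1+∣lessers∣*2≡n half (2x≈1⇒reflect-fixed 2*half≈1) reflect-fixed⇒half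

  1∉A+A : ¬ InSumset p A (oneₚ p)
  1∉A+A (a , b , a∈A , b∈A , a+b≡1) =
    lesser⇒¬lesser-ι (∈-lessers a∈A) (subst Lesser b≡ρa (∈-lessers b∈A))
    where
    b≡ρa : b ≡ reflect a
    b≡ρa = x+y≈1⇒y≡reflect (mod-≡⇒≈ a+b≡1)

  1∉AA : ¬ InProductset p A (oneₚ p)
  1∉AA (a , b , a∈A , b∈A , ab≡1) =
    reciprocals-not-both-lesser ab≈1 (∈-lessers a∈A) (∈-lessers b∈A)
    where
    ab≈1 : ⟦ a ⟧ * ⟦ b ⟧ ≈ 1ℤ
    ab≈1 = subst (_≈ 1ℤ) (ℤ.pos-* (toℕ a) (toℕ b)) (mod-≡⇒≈ ab≡1)

theorem2p2 : (p : ℕ) → .{{_ : NonZero p}} → Prime p → 5 ≤ p →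
    Σ (Subset p) λ A →
      (∣ A ∣ ≡ (p ∸ 1) / 2) × ¬ InSumset p A (oneₚ p) × ¬ InProductset p A (oneₚ p)
theorem2p2 p p-prime 5≤p = A , ∣A∣ , 1∉A+A , 1∉AA
  where open Construction p p-prime (ℕ.≤-trans (ℕ.m≤m+n 3 2) 5≤p)
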